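{- Let $U$ be a non-empty set and $\sqsubset$ a binary relation on $U$ such that mereological sums are unique: for every $S\subseteq U$ and all $x,y\in U$, if $x\,\mathrm{Sum}\,S$ and $y\,\mathrm{Sum}\,S$ then $x=y$. Then for all $x,y\in U$: if there exists $z\in U$ with $z\sqsubset x$, and for every $u\in U$ we have $u\sqsubset x \iff u\sqsubset y$, then $x=y$.
   Context: Here $x\sqsubset y$ is read "$x$ is a part of $y$". Define, for $x,y\in U$: $x\sqsubseteq y$ iff $x=y$ or $x\sqsubset y$; $x$ overlaps $y$ iff there exists $z\in U$ with $z\sqsubseteq x$ and $z\sqsubseteq y$. For $x\in U$ and $S\subseteq U$, $x\,\mathrm{Sum}\,S$ ("$x$ is a mereological sum of $S$") iff every $s\in S$ satisfies $s\sqsubseteq x$, and every $u\in U$ with $u\sqsubseteq x$ overlaps some element of $S$. -}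

module Defs where

open import Level using (0ℓ)
open import Data.Product using (Σ; ∃; _×_; _,_)
open import Data.Sum using (_⊎_)
open import Relation.Binary.PropositionalEquality using (_≡_)
open import Relation.Unary using (Pred; _∈_)

module Mereology {U : Set} (_⊏_ : U → U → Set) where

  _⊑_ : U → U → Set
  x ⊑ y = (x ≡ y) ⊎ (x ⊏ y)

  Overlaps : U → U → Set
  Overlaps x y = Σ U λ z → (z ⊑ x) × (z ⊑ y)

  Sum : U → Pred U 0ℓ → Set
  Sum x S = (∀ s → s ∈ S → s ⊑ x)
          × (∀ u → u ⊑ x → Σ U λ s → (s ∈ S) × Overlaps u s)

-- A part z of x shows that x is a sum of its own proper parts: x itself overlaps z, and every
-- proper part overlaps itself. Since y has exactly the same proper parts, y is a sum of the
-- same set, so uniqueness of sums forces x = y.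
module Submission where

open import Defs
open import Level using (0ℓ)
open import Data.Product using (Σ; _×_; _,_)
open import Data.Sum using (inj₁; inj₂)
open import Function.Base using (id)
open import Function.Bundles using (_⇔_; Equivalence)
open import Relation.Binary.PropositionalEquality using (_≡_; refl)
open import Relation.Unary using (Pred; _∈_; _≐_)

module _ {U : Set} (_⊏_ : U → U → Set) where
  open Mereology _⊏_

  ProperParts : U → Pred U 0ℓ
  ProperParts x u = u ⊏ x

  properParts-≐ : ∀ {x y} → (∀ u → (u ⊏ x) ⇔ (u ⊏ y)) → ProperParts x ≐ ProperParts y
  properParts-≐ same = (λ {u} → Equivalence.to (same u)) , (λ {u} → Equivalence.from (same u))

  sum-properParts : ∀ {x S} → S ≐ ProperParts x → Σ U (_∈ S) → Sum x S
  sum-properParts {x} {S} (S⊆parts , parts⊆S) (z , z∈S) = parts⊑x , overlapsMember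
    where
    parts⊑x : ∀ s → s ∈ S → s ⊑ x
    parts⊑x s s∈S = inj₂ (S⊆parts s∈S)

    overlapsMember : ∀ u → u ⊑ x → Σ U λ s → (s ∈ S) × Overlaps u s
    overlapsMember u (inj₁ refl) = z , z∈S , z , parts⊑x z z∈S , inj₁ refl
    overlapsMember u (inj₂ u⊏x)  = u , parts⊆S u⊏x , u , inj₁ refl , inj₁ refl

mainTheorem4 : (U : Set) → U → (_⊏_ : U → U → Set) →
    (∀ (S : Pred U 0ℓ) (x y : U) → Mereology.Sum _⊏_ x S → Mereology.Sum _⊏_ y S → x ≡ y) →
    ∀ (x y : U) → (Σ U λ z → z ⊏ x) → (∀ u → (u ⊏ x) ⇔ (u ⊏ y)) → x ≡ y
mainTheorem4 U _ _⊏_ sum-unique x y hasPart sameParts =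
  sum-unique (ProperParts _⊏_ x) x y
    (sum-properParts _⊏_ (id , id) hasPart)
    (sum-properParts _⊏_ (properParts-≐ _⊏_ sameParts) hasPart)
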